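{- For every positive integer $n$, the Harary graph $H_{2n,2n+3}$ is $(2n^2+3n-1,1)$-distance antimagic.
   Context: $H_{2n,2n+3}$ has vertices $v_0,\dots,v_{2n+2}$ with $v_i\sim v_j$ iff $i\ne j$ and $j\equiv i+t\pmod{2n+3}$ for some $t$ with $1\le |t|\le n$ (the $n$-th power of the cycle $C_{2n+3}$). For integers $a$ and $d\ge 0$, an $(a,d)$-distance antimagic labeling of a graph $G$ on $N$ vertices is a bijection $f:V(G)\to\{1,\dots,N\}$ such that the set of vertex weights $\{\sum_{v\in N_G(u)}f(v): u\in V(G)\}$ equals $\{a,a+d,\dots,a+(N-1)d\}$; $G$ is $(a,d)$-distance antimagic if it admits one. -}

module Defs where

open import Data.Nat using (ℕ; zero; suc; _+_; _*_; _<_; _%_; NonZero)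
open import Data.Nat.Properties using (_≟_)
open import Data.Fin using (Fin; toℕ)
open import Data.Bool using (Bool; true; false; if_then_else_; _∧_; _∨_; not)
open import Data.List using (List; map; upTo; filter; allFin)
open import Data.Nat.ListAction using (sum)
open import Data.Bool.ListAction using (any)
open import Data.Product using (Σ; ∃; ∃-syntax; _×_; _,_)
open import Function.Definitions using (Bijective)
open import Relation.Binary.PropositionalEquality using (_≡_)
open import Relation.Nullary.Decidable using (⌊_⌋)
open import Data.Fin using () renaming (_≟_ to _≟ᶠ_)

Graph : ℕ → Set
Graph N = Fin N → Fin N → Bool

-- The Harary graph H_{2n,2n+3}: vertices v_0,…,v_{2n+2} (as Fin (2n+3)),
-- (3 + 2 * n = 2n+3, written so the modulus is syntactically nonzero)
-- v_i ~ v_j iff i ≠ j and j ≡ i + t (mod 2n+3) for some t with 1 ≤ |t| ≤ n.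
-- For t = s or t = -s with 1 ≤ s ≤ n this is: (i + s) mod m = j or (j + s) mod m = i.
harary : (n : ℕ) → Graph (3 + 2 * n)
harary n i j =
  not ⌊ i ≟ᶠ j ⌋ ∧
  any (λ s → ⌊ (toℕ i + suc s) % (3 + 2 * n) ≟ toℕ j ⌋
           ∨ ⌊ (toℕ j + suc s) % (3 + 2 * n) ≟ toℕ i ⌋) (upTo n)

-- Label of vertex v under a bijection f : V → {1,…,N}, encoded as Fin N (label = toℕ + 1).
label : {N : ℕ} → (Fin N → Fin N) → Fin N → ℕ
label f v = suc (toℕ (f v))

weight : {N : ℕ} → Graph N → (Fin N → Fin N) → Fin N → ℕ
weight {N} G f u = sum (map (label f) (filter (λ v → G u v Data.Bool.≟ true) (allFin N)))

-- f is an (a,d)-distance antimagic labeling of G: f is a bijection V → {1,…,N} and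
-- { weight u : u ∈ V } = { a, a+d, …, a+(N-1)d } (equality of sets).
IsDistanceAntimagicLabeling : {N : ℕ} → Graph N → ℕ → ℕ → (Fin N → Fin N) → Set
IsDistanceAntimagicLabeling {N} G a d f =
  Bijective _≡_ _≡_ f
  × (∀ u → ∃[ k ] (k < N × weight G f u ≡ a + k * d))
  × (∀ k → k < N → ∃[ u ] (weight G f u ≡ a + k * d))

IsDistanceAntimagic : {N : ℕ} → Graph N → ℕ → ℕ → Set
IsDistanceAntimagic {N} G a d = ∃[ f ] IsDistanceAntimagicLabeling G a d f

module Submission where

-- In H_{2n,2n+3} a vertex v_i is adjacent to every vertex except itself and the two vertices
-- v_{i+n+1}, v_{i+n+2} at clockwise distance n+1 and n+2, so its weight is 1 + 2 + ⋯ + (2n+3)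
-- minus the labels of v_i, v_{i+n+1}, v_{i+n+2}. Label v_j by j + 1 after swapping v_0 with
-- v_{n+1} and reversing v_{n+2}, …, v_{2n+2}. A case check over six kinds of vertex shows that
-- these 2n+3 triple sums are K − k for k = 0, …, 2n+2, each once, so the weights are the
-- consecutive integers A, A + 1, …, A + 2n + 2.

open import Defs
open import Data.Nat using (ℕ; zero; suc; _+_; _*_; _∸_; _≤_; _<_; _≤?_; _<?_; z≤n; s≤s; s≤s⁻¹; z<s; NonZero; _%_)
open import Data.Nat.Properties
open import Data.Nat.DivMod using (_mod_; m%n<n; m<n⇒m%n≡m; [m+n]%n≡m%n; m%n%n≡m%n; %-distribˡ-+; n%n≡0)
open import Data.Nat.Tactic.RingSolver using (solve-∀; solve)
open import Data.Bool using (Bool; true; false; if_then_else_; _∧_; _∨_; not)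
import Data.Bool as Bool
open import Data.Bool.Properties using (∨-zeroʳ; ∧-zeroʳ)
open import Data.Bool.ListAction using (any)
open import Data.Fin as Fin using (Fin; toℕ; fromℕ; fromℕ<; inject₁; punchIn)
open import Data.Fin.Properties using (toℕ-inject₁; toℕ-fromℕ; toℕ-fromℕ<; toℕ<n; toℕ-injective; punchInᵢ≢i)
  renaming (_≟_ to _≟ᶠ_)
open import Data.List using (List; []; _∷_; map; filter; tabulate; allFin; upTo)
open import Data.List.Properties using (map-tabulate)
open import Data.List.Membership.Propositional using (_∈_)
open import Data.List.Membership.Propositional.Properties using (∈-upTo⁺; ∈-upTo⁻)
open import Data.List.Relation.Unary.Any using (here; there)
import Data.Nat.ListAction as List
open import Data.Product using (∃; _×_; _,_; proj₁; proj₂)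
open import Data.Sum using (_⊎_; inj₁; inj₂)
open import Function using (_∘_)
open import Function.Bundles using (_⇔_; mk⇔; Equivalence; Bijection)
open import Function.Properties.Inverse using (↔⇒⤖)
open import Algebra.Properties.CommutativeMonoid.Sum +-0-commutativeMonoid
  using (sum; sum-syntax; sum-cong-≗; sum-remove; sum-init-last; sum-replicate-zero; ∑-distrib-+; sum-permute)
open import Data.Fin.Permutation using (Permutation′; permutation)
open import Relation.Nullary using (yes; no; contradiction)
open import Relation.Nullary.Decidable using (⌊_⌋)
open import Relation.Binary.PropositionalEquality

mask : ∀ {A : Set} → (A → Bool) → (A → ℕ) → A → ℕ
mask h g x = if h x then g x else 0

only : ∀ {k} → Fin k → (Fin k → ℕ) → Fin k → ℕ
only c g = mask (λ v → ⌊ v ≟ᶠ c ⌋) g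

sum-map-filter : ∀ {A : Set} (h : A → Bool) (g : A → ℕ) (xs : List A) →
                 List.sum (map g (filter (λ x → h x Bool.≟ true) xs)) ≡ List.sum (map (mask h g) xs)
sum-map-filter h g [] = refl
sum-map-filter h g (x ∷ xs) with h x
... | true  = cong (g x +_) (sum-map-filter h g xs)
... | false = sum-map-filter h g xs

sum-tabulate : ∀ {k} (g : Fin k → ℕ) → List.sum (tabulate g) ≡ sum g
sum-tabulate {zero}  g = refl
sum-tabulate {suc k} g = cong (g Fin.zero +_) (sum-tabulate (λ v → g (Fin.suc v)))

weight≡∑ : ∀ {k} (G : Graph k) (f : Fin k → Fin k) (u : Fin k) → weight G f u ≡ sum (mask (G u) (label f))
weight≡∑ {k} G f u = begin
  weight G f u                                   ≡⟨ sum-map-filter (G u) (label f) (allFin k) ⟩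
  List.sum (map (mask (G u) (label f)) (allFin k)) ≡⟨ cong List.sum (map-tabulate (λ v → v) (mask (G u) (label f))) ⟩
  List.sum (tabulate (mask (G u) (label f)))       ≡⟨ sum-tabulate (mask (G u) (label f)) ⟩
  sum (mask (G u) (label f))                       ∎
  where open ≡-Reasoning

∑-only : ∀ {k} (c : Fin k) (g : Fin k → ℕ) → sum (only c g) ≡ g c
∑-only {suc k} c g = begin
  sum (only c g)                                  ≡⟨ sum-remove {i = c} (only c g) ⟩
  only c g c + ∑[ j < k ] only c g (punchIn c j)  ≡⟨ cong₂ _+_ at-c (sum-cong-≗ (λ j → off-c (punchInᵢ≢i c j))) ⟩
  g c + ∑[ j < k ] 0                              ≡⟨ cong (g c +_) (sum-replicate-zero k) ⟩
  g c + 0                                         ≡⟨ +-identityʳ (g c) ⟩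
  g c                                             ∎
  where
  open ≡-Reasoning
  at-c : only c g c ≡ g c
  at-c with c ≟ᶠ c
  ... | yes _  = refl
  ... | no c≢c = contradiction refl c≢c
  off-c : ∀ {v} → v ≢ c → only c g v ≡ 0
  off-c {v} v≢c with v ≟ᶠ c
  ... | yes v≡c = contradiction v≡c v≢c
  ... | no _    = refl

∑-mask-complement : ∀ {k} (h : Fin k → Bool) (g : Fin k → ℕ) {a b c : Fin k} →
                    a ≢ b → a ≢ c → b ≢ c →
                    (∀ v → h v ≡ false ⇔ (v ≡ a ⊎ v ≡ b ⊎ v ≡ c)) →
                    sum (mask h g) + (g a + (g b + g c)) ≡ sum g
∑-mask-complement {k} h g {a} {b} {c} a≢b a≢c b≢c off⇔ = begin
  sum (mask h g) + (g a + (g b + g c))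
    ≡⟨ cong (λ x → sum (mask h g) + x) (sym (cong₂ _+_ (∑-only a g) (cong₂ _+_ (∑-only b g) (∑-only c g)))) ⟩
  sum (mask h g) + (sum (only a g) + (sum (only b g) + sum (only c g)))
    ≡⟨ cong (λ x → sum (mask h g) + (sum (only a g) + x)) (sym (∑-distrib-+ (only b g) (only c g))) ⟩
  sum (mask h g) + (sum (only a g) + ∑[ v < k ] (only b g v + only c g v))
    ≡⟨ cong (λ x → sum (mask h g) + x) (sym (∑-distrib-+ (only a g) _)) ⟩
  sum (mask h g) + ∑[ v < k ] (only a g v + (only b g v + only c g v))
    ≡⟨ sym (∑-distrib-+ (mask h g) _) ⟩
  ∑[ v < k ] (mask h g v + (only a g v + (only b g v + only c g v)))
    ≡⟨ sum-cong-≗ pointwise ⟩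
  sum g ∎
  where
  open ≡-Reasoning
  open Equivalence
  pointwise : ∀ v → mask h g v + (only a g v + (only b g v + only c g v)) ≡ g v
  pointwise v with h v in hv | v ≟ᶠ a | v ≟ᶠ b | v ≟ᶠ c
  ... | true  | no _     | no _     | no _     = +-identityʳ (g v)
  ... | true  | yes refl | _        | _        = contradiction (trans (sym hv) (from (off⇔ v) (inj₁ refl))) λ ()
  ... | true  | no _     | yes refl | _        = contradiction (trans (sym hv) (from (off⇔ v) (inj₂ (inj₁ refl)))) λ ()
  ... | true  | no _     | no _     | yes refl = contradiction (trans (sym hv) (from (off⇔ v) (inj₂ (inj₂ refl)))) λ ()
  ... | false | yes refl | no _     | no _     = +-identityʳ (g v)
  ... | false | no _     | yes refl | no _     = +-identityʳ (g v)
  ... | false | no _     | no _     | yes refl = refl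
  ... | false | yes refl | yes v≡b  | _        = contradiction v≡b a≢b
  ... | false | yes refl | no _     | yes v≡c  = contradiction v≡c a≢c
  ... | false | no _     | yes refl | yes v≡c  = contradiction v≡c b≢c
  ... | false | no v≢a   | no v≢b   | no v≢c   with to (off⇔ v) hv
  ...   | inj₁ v≡a        = contradiction v≡a v≢a
  ...   | inj₂ (inj₁ v≡b) = contradiction v≡b v≢b
  ...   | inj₂ (inj₂ v≡c) = contradiction v≡c v≢c

weight-complement : ∀ {k} (G : Graph k) (f : Fin k → Fin k) (u : Fin k) {a b c : Fin k} →
                    a ≢ b → a ≢ c → b ≢ c →
                    (∀ v → G u v ≡ false ⇔ (v ≡ a ⊎ v ≡ b ⊎ v ≡ c)) →
                    weight G f u + (label f a + (label f b + label f c)) ≡ sum (label f)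
weight-complement G f u a≢b a≢c b≢c off⇔ =
  trans (cong (_+ _) (weight≡∑ G f u)) (∑-mask-complement (G u) (label f) a≢b a≢c b≢c off⇔)

double-∑-suc-toℕ : ∀ k → 2 * ∑[ v < k ] suc (toℕ v) ≡ k * suc k
double-∑-suc-toℕ zero    = refl
double-∑-suc-toℕ (suc k) = begin
  2 * ∑[ v < suc k ] suc (toℕ v)
    ≡⟨ cong (2 *_) (sum-init-last {k} (λ v → suc (toℕ v))) ⟩
  2 * (∑[ v < k ] suc (toℕ (inject₁ v)) + suc (toℕ (fromℕ k)))
    ≡⟨ cong₂ (λ s t → 2 * (s + suc t)) (sum-cong-≗ {k} (λ v → cong suc (toℕ-inject₁ v))) (toℕ-fromℕ k) ⟩
  2 * (∑[ v < k ] suc (toℕ v) + suc k)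
    ≡⟨ *-distribˡ-+ 2 (∑[ v < k ] suc (toℕ v)) (suc k) ⟩
  2 * ∑[ v < k ] suc (toℕ v) + 2 * suc k
    ≡⟨ cong (_+ 2 * suc k) (double-∑-suc-toℕ k) ⟩
  k * suc k + 2 * suc k
    ≡⟨ factor k ⟩
  suc k * suc (suc k) ∎
  where
  open ≡-Reasoning
  factor : ∀ k → k * suc k + 2 * suc k ≡ suc k * suc (suc k)
  factor = solve-∀

module ClockwiseDistance (m : ℕ) .{{_ : NonZero m}} where

  [x%m+y]%m≡[x+y]%m : ∀ x y → (x % m + y) % m ≡ (x + y) % m
  [x%m+y]%m≡[x+y]%m x y = begin
    (x % m + y) % m            ≡⟨ %-distribˡ-+ (x % m) y m ⟩
    (x % m % m + y % m) % m    ≡⟨ cong (λ r → (r + y % m) % m) (m%n%n≡m%n x m) ⟩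
    (x % m + y % m) % m        ≡⟨ sym (%-distribˡ-+ x y m) ⟩
    (x + y) % m                ∎
    where open ≡-Reasoning

  δ : ℕ → ℕ → ℕ
  δ i j = (j + (m ∸ i)) % m

  δ<m : ∀ i j → δ i j < m
  δ<m i j = m%n<n (j + (m ∸ i)) m

  δ-unique : ∀ {i j t} → i ≤ m → t < m → (i + t) % m ≡ j → δ i j ≡ t
  δ-unique {i} {j} {t} i≤m t<m i+t≡j = begin
    (j + (m ∸ i)) % m            ≡⟨ cong (λ r → (r + (m ∸ i)) % m) (sym i+t≡j) ⟩
    ((i + t) % m + (m ∸ i)) % m  ≡⟨ [x%m+y]%m≡[x+y]%m (i + t) (m ∸ i) ⟩
    (i + t + (m ∸ i)) % m        ≡⟨ cong (_% m) (i+t+[m∸i]≡t+m) ⟩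
    (t + m) % m                  ≡⟨ [m+n]%n≡m%n t m ⟩
    t % m                        ≡⟨ m<n⇒m%n≡m t<m ⟩
    t                            ∎
    where
    open ≡-Reasoning
    i+t+[m∸i]≡t+m : i + t + (m ∸ i) ≡ t + m
    i+t+[m∸i]≡t+m = begin
      i + t + (m ∸ i)    ≡⟨ cong (_+ (m ∸ i)) (+-comm i t) ⟩
      t + i + (m ∸ i)    ≡⟨ +-assoc t i (m ∸ i) ⟩
      t + (i + (m ∸ i))  ≡⟨ cong (t +_) (m+[n∸m]≡n i≤m) ⟩
      t + m              ∎

  [i+δ]%m≡j : ∀ {i j} → i ≤ m → j < m → (i + δ i j) % m ≡ j
  [i+δ]%m≡j {i} {j} i≤m j<m = begin
    (i + δ i j) % m               ≡⟨ cong (_% m) (+-comm i (δ i j)) ⟩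
    (δ i j + i) % m               ≡⟨ [x%m+y]%m≡[x+y]%m (j + (m ∸ i)) i ⟩
    (j + (m ∸ i) + i) % m         ≡⟨ cong (_% m) (+-assoc j (m ∸ i) i) ⟩
    (j + ((m ∸ i) + i)) % m       ≡⟨ cong (λ r → (j + r) % m) (m∸n+n≡m i≤m) ⟩
    (j + m) % m                   ≡⟨ [m+n]%n≡m%n j m ⟩
    j % m                         ≡⟨ m<n⇒m%n≡m j<m ⟩
    j                             ∎
    where open ≡-Reasoning

  δ-injective : ∀ {i j k} → i ≤ m → j < m → k < m → δ i j ≡ δ i k → j ≡ k
  δ-injective {i} i≤m j<m k<m eq =
    trans (sym ([i+δ]%m≡j i≤m j<m)) (trans (cong (λ r → (i + r) % m) eq) ([i+δ]%m≡j i≤m k<m))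

  δ-self : ∀ {i} → i < m → δ i i ≡ 0
  δ-self {i} i<m = δ-unique (<⇒≤ i<m) (≤-<-trans z≤n i<m) (trans (cong (_% m) (+-identityʳ i)) (m<n⇒m%n≡m i<m))

  δ+δ≡m : ∀ {i j} → i < m → j < m → i ≢ j → δ i j + δ j i ≡ m
  δ+δ≡m {i} {j} i<m j<m i≢j = begin
    d + δ j i    ≡⟨ cong (d +_) (δ-unique (<⇒≤ j<m) (∸-monoʳ-< 0<d (<⇒≤ (δ<m i j))) j+[m∸d]≡i) ⟩
    d + (m ∸ d)  ≡⟨ m+[n∸m]≡n (<⇒≤ (δ<m i j)) ⟩
    m            ∎
    where
    open ≡-Reasoning
    d = δ i j
    i+d≡j : (i + d) % m ≡ j
    i+d≡j = [i+δ]%m≡j (<⇒≤ i<m) j<m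
    0<d : 0 < d
    0<d = n≢0⇒n>0 λ d≡0 → i≢j (sym (δ-injective (<⇒≤ i<m) j<m i<m (trans d≡0 (sym (δ-self i<m)))))
    j+[m∸d]≡i : (j + (m ∸ d)) % m ≡ i
    j+[m∸d]≡i = begin
      (j + (m ∸ d)) % m             ≡⟨ cong (λ r → (r + (m ∸ d)) % m) (sym i+d≡j) ⟩
      ((i + d) % m + (m ∸ d)) % m   ≡⟨ [x%m+y]%m≡[x+y]%m (i + d) (m ∸ d) ⟩
      (i + d + (m ∸ d)) % m         ≡⟨ cong (_% m) (trans (+-assoc i d (m ∸ d)) (cong (i +_) (m+[n∸m]≡n (<⇒≤ (δ<m i j))))) ⟩
      (i + m) % m                   ≡⟨ [m+n]%n≡m%n i m ⟩
      i % m                         ≡⟨ m<n⇒m%n≡m i<m ⟩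
      i                             ∎

any-true : ∀ {A : Set} (p : A → Bool) {x : A} {xs : List A} → x ∈ xs → p x ≡ true → any p xs ≡ true
any-true p {xs = y ∷ ys} (here refl) px≡true rewrite px≡true = refl
any-true p {xs = y ∷ ys} (there x∈ys) px≡true rewrite any-true p x∈ys px≡true = ∨-zeroʳ (p y)

any-false : ∀ {A : Set} (p : A → Bool) (xs : List A) → (∀ {x} → x ∈ xs → p x ≡ false) → any p xs ≡ false
any-false p []       _ = refl
any-false p (x ∷ xs) all-false rewrite all-false (here refl) = any-false p xs (all-false ∘ there)

module HararyNeighbourhood (n : ℕ) where

  m : ℕ
  m = 3 + 2 * n

  open ClockwiseDistance m

  rotate : ℕ → Fin m → Fin m
  rotate t u = (toℕ u + t) mod m

  toℕ-rotate : ∀ t u → toℕ (rotate t u) ≡ (toℕ u + t) % m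
  toℕ-rotate t u = toℕ-fromℕ< (m%n<n (toℕ u + t) m)

  δ-rotate : ∀ {t} u → t < m → δ (toℕ u) (toℕ (rotate t u)) ≡ t
  δ-rotate {t} u t<m = δ-unique (<⇒≤ (toℕ<n u)) t<m (sym (toℕ-rotate t u))

  δ-toℕ-injective : ∀ u {v w} → δ (toℕ u) (toℕ v) ≡ δ (toℕ u) (toℕ w) → v ≡ w
  δ-toℕ-injective u {v} {w} eq = toℕ-injective (δ-injective (<⇒≤ (toℕ<n u)) (toℕ<n v) (toℕ<n w) eq)

  linked : ℕ → ℕ → ℕ → Bool
  linked i j s = ⌊ (i + suc s) % m ≟ j ⌋ ∨ ⌊ (j + suc s) % m ≟ i ⌋

  2+n<m : 2 + n < m
  2+n<m = s≤s (s≤s (s≤s (m≤m+n n (n + 0))))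

  1+n<m : suc n < m
  1+n<m = <-trans (n<1+n (suc n)) 2+n<m

  n<m : n < m
  n<m = <-trans (n<1+n n) 1+n<m

  suc<m : ∀ {s} → s < n → suc s < m
  suc<m s<n = ≤-<-trans s<n n<m

  2+n+n<m : 2 + n + n < m
  2+n+n<m = ≤-reflexive (cong (λ r → 3 + (n + r)) (sym (+-identityʳ n)))

  linked-far : ∀ {i j} → i < m → j < m → suc n ≤ δ i j → δ i j ≤ 2 + n →
               any (linked i j) (upTo n) ≡ false
  linked-far {i} {j} i<m j<m n<d d≤2+n = any-false (linked i j) (upTo n) (λ s∈ → not-linked (∈-upTo⁻ s∈))
    where
    d = δ i j
    i≢j : i ≢ j
    i≢j refl = contradiction (subst (suc n ≤_) (δ-self i<m) n<d) λ ()
    not-linked : ∀ {s} → s < n → linked i j s ≡ false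
    not-linked {s} s<n with (i + suc s) % m ≟ j | (j + suc s) % m ≟ i
    ... | yes i+s≡j | _ = contradiction (≤-trans n<d (≤-reflexive (δ-unique (<⇒≤ i<m) (suc<m s<n) i+s≡j))) (<⇒≱ (s≤s s<n))
    ... | no _ | yes j+s≡i = contradiction (begin-strict
          m                    ≡⟨ sym (δ+δ≡m i<m j<m i≢j) ⟩
          d + δ j i            ≡⟨ cong (d +_) (δ-unique (<⇒≤ j<m) (suc<m s<n) j+s≡i) ⟩
          d + suc s            ≤⟨ +-mono-≤ d≤2+n s<n ⟩
          2 + n + n            <⟨ 2+n+n<m ⟩
          m                    ∎) (<-irrefl refl)
      where open ≤-Reasoning
    ... | no _ | no _ = refl

  linked-forward : ∀ {i j s} → (i + suc s) % m ≡ j → linked i j s ≡ true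
  linked-forward {i} {j} {s} i+s≡j with (i + suc s) % m ≟ j
  ... | yes _    = refl
  ... | no i+s≢j = contradiction i+s≡j i+s≢j

  linked-backward : ∀ {i j s} → (j + suc s) % m ≡ i → linked i j s ≡ true
  linked-backward {i} {j} {s} j+s≡i with (i + suc s) % m ≟ j | (j + suc s) % m ≟ i
  ... | yes _ | _        = refl
  ... | no _  | yes _    = refl
  ... | no _  | no j+s≢i = contradiction j+s≡i j+s≢i

  predecessor : ∀ {d} → d ≢ 0 → ∃ λ s → suc s ≡ d
  predecessor {zero}  d≢0 = contradiction refl d≢0
  predecessor {suc s} _   = s , refl

  linked-near : ∀ {i j} → i < m → j < m → δ i j ≢ 0 → δ i j ≢ suc n → δ i j ≢ 2 + n →
                any (linked i j) (upTo n) ≡ true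
  linked-near {i} {j} i<m j<m d≢0 d≢1+n d≢2+n with δ i j ≤? n
  ... | yes d≤n = any-true (linked i j) (∈-upTo⁺ s<n) (linked-forward i+s≡j)
    where
    s = proj₁ (predecessor d≢0)
    s+1≡d = proj₂ (predecessor d≢0)
    s<n : s < n
    s<n = subst (_≤ n) (sym s+1≡d) d≤n
    i+s≡j : (i + suc s) % m ≡ j
    i+s≡j = trans (cong (λ r → (i + r) % m) s+1≡d) ([i+δ]%m≡j (<⇒≤ i<m) j<m)
  ... | no d≰n = any-true (linked i j) (∈-upTo⁺ s<n) (linked-backward j+s≡i)
    where
    d = δ i j
    e = δ j i
    i≢j : i ≢ j
    i≢j refl = d≢0 (δ-self i<m)
    d+e≡m : d + e ≡ m
    d+e≡m = δ+δ≡m i<m j<m i≢j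
    e≢0 : e ≢ 0
    e≢0 e≡0 = <-irrefl (trans (sym (+-identityʳ d)) (trans (cong (d +_) (sym e≡0)) d+e≡m)) (δ<m i j)
    3+n≤d : 3 + n ≤ d
    3+n≤d = ≤∧≢⇒< (≤∧≢⇒< (≰⇒> d≰n) (d≢1+n ∘ sym)) (d≢2+n ∘ sym)
    e≤n : e ≤ n
    e≤n = +-cancelˡ-≤ (3 + n) e n (begin
      3 + n + e   ≤⟨ +-monoˡ-≤ e 3+n≤d ⟩
      d + e       ≡⟨ d+e≡m ⟩
      m           ≡⟨ cong (λ r → 3 + (n + r)) (+-identityʳ n) ⟩
      3 + n + n   ∎)
      where open ≤-Reasoning
    s = proj₁ (predecessor e≢0)
    s+1≡e = proj₂ (predecessor e≢0)
    s<n : s < n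
    s<n = subst (_≤ n) (sym s+1≡e) e≤n
    j+s≡i : (j + suc s) % m ≡ i
    j+s≡i = trans (cong (λ r → (j + r) % m) s+1≡e) ([i+δ]%m≡j (<⇒≤ j<m) i<m)

  harary-non-neighbour : ∀ u v → harary n u v ≡ false ⇔ (v ≡ u ⊎ v ≡ rotate (suc n) u ⊎ v ≡ rotate (2 + n) u)
  harary-non-neighbour u v = mk⇔ classify non-adjacent
    where
    i = toℕ u
    j = toℕ v
    classify : harary n u v ≡ false → v ≡ u ⊎ v ≡ rotate (suc n) u ⊎ v ≡ rotate (2 + n) u
    classify h with δ i j ≟ 0 | δ i j ≟ suc n | δ i j ≟ 2 + n
    ... | yes d≡0 | _         | _         = inj₁ (δ-toℕ-injective u (trans d≡0 (sym (δ-self (toℕ<n u)))))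
    ... | no _    | yes d≡1+n | _         = inj₂ (inj₁ (δ-toℕ-injective u (trans d≡1+n (sym (δ-rotate u 1+n<m)))))
    ... | no _    | no _      | yes d≡2+n = inj₂ (inj₂ (δ-toℕ-injective u (trans d≡2+n (sym (δ-rotate u 2+n<m)))))
    ... | no d≢0  | no d≢1+n  | no d≢2+n with u ≟ᶠ v
    ...   | yes refl = contradiction (δ-self (toℕ<n u)) d≢0
    ...   | no _     = contradiction (trans (sym h) (linked-near (toℕ<n u) (toℕ<n v) d≢0 d≢1+n d≢2+n)) λ ()
    far : ∀ {t} → t < m → suc n ≤ t → t ≤ 2 + n → harary n u (rotate t u) ≡ false
    far {t} t<m n<t t≤2+n = trans (cong (not ⌊ u ≟ᶠ rotate t u ⌋ ∧_) (linked-far (toℕ<n u) (toℕ<n (rotate t u))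
                                      (subst (suc n ≤_) (sym (δ-rotate u t<m)) n<t)
                                      (subst (_≤ 2 + n) (sym (δ-rotate u t<m)) t≤2+n)))
                                  (∧-zeroʳ _)
    non-adjacent : v ≡ u ⊎ v ≡ rotate (suc n) u ⊎ v ≡ rotate (2 + n) u → harary n u v ≡ false
    non-adjacent (inj₁ refl) with u ≟ᶠ u
    ... | yes _   = refl
    ... | no u≢u  = contradiction refl u≢u
    non-adjacent (inj₂ (inj₁ refl)) = far 1+n<m ≤-refl (n≤1+n (suc n))
    non-adjacent (inj₂ (inj₂ refl)) = far 2+n<m (n≤1+n (suc n)) ≤-refl

  ≢rotate : ∀ {t} u → t < m → t ≢ 0 → u ≢ rotate t u
  ≢rotate {t} u t<m t≢0 u≡ = t≢0 (begin
    t                              ≡⟨ sym (δ-rotate u t<m) ⟩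
    δ (toℕ u) (toℕ (rotate t u))   ≡⟨ cong (λ w → δ (toℕ u) (toℕ w)) (sym u≡) ⟩
    δ (toℕ u) (toℕ u)              ≡⟨ δ-self (toℕ<n u) ⟩
    0                              ∎)
    where open ≡-Reasoning

  rotate-≢ : ∀ {s t} u → s < m → t < m → s ≢ t → rotate s u ≢ rotate t u
  rotate-≢ {s} {t} u s<m t<m s≢t eq = s≢t (begin
    s                              ≡⟨ sym (δ-rotate u s<m) ⟩
    δ (toℕ u) (toℕ (rotate s u))   ≡⟨ cong (λ w → δ (toℕ u) (toℕ w)) eq ⟩
    δ (toℕ u) (toℕ (rotate t u))   ≡⟨ δ-rotate u t<m ⟩
    t                              ∎)
    where open ≡-Reasoning

-- The paper's n is suc n here: m = 2q + 1, and the non-neighbours of v_i are v_{i+q}, v_{i+q+1}.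
module Labelling (n : ℕ) where

  open HararyNeighbourhood (suc n)

  q : ℕ
  q = 2 + n

  m≡1+q+q : m ≡ suc (q + q)
  m≡1+q+q = begin
    3 + 2 * suc n                 ≡⟨ solve (n ∷ []) ⟩
    suc (suc (suc n) + suc (suc n)) ∎
    where open ≡-Reasoning

  σ : ℕ → ℕ
  σ i = if ⌊ i ≟ 0 ⌋ then q
        else if ⌊ i <? q ⌋ then i
        else if ⌊ i ≟ q ⌋ then 0
        else m + q ∸ i

  σ-low : ∀ {y} → y ≤ n → σ (suc y) ≡ suc y
  σ-low {y} y≤n with suc y <? q
  ... | yes _      = refl
  ... | no 1+y≮q   = contradiction (s≤s (s≤s y≤n)) 1+y≮q

  σ-mid : σ q ≡ 0
  σ-mid with q <? q | q ≟ q
  ... | yes q<q | _      = contradiction q<q (<-irrefl refl)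
  ... | no _    | yes _  = refl
  ... | no _    | no q≢q = contradiction refl q≢q

  σ-high : ∀ j k → j + k ≡ suc n → σ (suc j + q) ≡ suc k + q
  σ-high j k j+k≡1+n with suc j + q <? q | suc j + q ≟ q
  ... | yes lt | _   = contradiction lt (≤⇒≯ (m≤n+m q (suc j)))
  ... | no _   | yes eq = contradiction eq (<⇒≢ (s≤s (m≤n+m q j)) ∘ sym)
  ... | no _   | no _ = begin
    m + q ∸ (suc j + q)                       ≡⟨ cong (_∸ (suc j + q)) split ⟩
    (suc j + q) + (suc k + q) ∸ (suc j + q)   ≡⟨ m+n∸m≡n (suc j + q) (suc k + q) ⟩
    suc k + q                                 ∎
    where
    open ≡-Reasoning
    split : m + q ≡ (suc j + q) + (suc k + q)
    split = begin
      3 + 2 * suc n + suc (suc n)                 ≡⟨ cong (λ x → 3 + 2 * x + suc x) (sym j+k≡1+n) ⟩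
      3 + 2 * (j + k) + suc (j + k)               ≡⟨ solve (j ∷ k ∷ []) ⟩
      suc j + suc (j + k) + (suc k + suc (j + k)) ≡⟨ cong (λ x → suc j + suc x + (suc k + suc x)) j+k≡1+n ⟩
      (suc j + q) + (suc k + q)                   ∎

  +q<m : ∀ {a} → a ≤ q → a + q < m
  +q<m {a} a≤q = begin-strict
    a + q        ≤⟨ +-monoˡ-≤ q a≤q ⟩
    q + q        <⟨ n<1+n (q + q) ⟩
    suc (q + q)  ≡⟨ sym m≡1+q+q ⟩
    m            ∎
    where open ≤-Reasoning

  q<m : q < m
  q<m = +q<m z≤n

  ≤q⇒<m : ∀ {a} → a ≤ q → a < m
  ≤q⇒<m a≤q = ≤-<-trans a≤q q<m

  data Row : ℕ → Set where
    origin : Row 0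
    low    : ∀ y e → y + e ≡ n → Row (suc y)
    mid    : Row q
    next   : Row (suc q)
    high   : ∀ j e → j + suc e ≡ n → Row (suc (suc j) + q)
    last   : Row (q + q)

  row-above-mid : ∀ a → a ≤ suc n → Row (suc a + q)
  row-above-mid zero         _     = next
  row-above-mid (suc j)      a≤1+n with j <? n
  ... | yes j<n = high j (n ∸ suc j) (trans (+-suc j (n ∸ suc j)) (m+[n∸m]≡n j<n))
  ... | no j≮n  with j ≟ n
  ...   | yes refl = last
  ...   | no j≢n   = contradiction (≤∧≢⇒< (s≤s⁻¹ a≤1+n) j≢n) j≮n

  row : ∀ {i} → i < m → Row i
  row {zero}  _   = origin
  row {suc y} i<m with y ≤? n
  ... | yes y≤n = low y (n ∸ y) (m+[n∸m]≡n y≤n)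
  ... | no y≰n  with y ≟ suc n
  ...   | yes refl = mid
  ...   | no y≢1+n = subst Row (cong suc a+q≡y) (row-above-mid a a≤1+n)
    where
    q≤y : q ≤ y
    q≤y = ≤∧≢⇒< (≰⇒> y≰n) (y≢1+n ∘ sym)
    a = y ∸ q
    a+q≡y : a + q ≡ y
    a+q≡y = m∸n+n≡m q≤y
    a≤1+n : a ≤ suc n
    a≤1+n = +-cancelʳ-≤ q a (suc n) (s≤s⁻¹ (s≤s⁻¹ (begin-strict
      suc (a + q)      ≡⟨ cong suc a+q≡y ⟩
      suc y            <⟨ i<m ⟩
      m                ≡⟨ m≡1+q+q ⟩
      suc (q + q)      ∎)))
      where open ≤-Reasoning

  σ-high-involutive : ∀ j k → j + k ≡ suc n → σ (σ (suc j + q)) ≡ suc j + q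
  σ-high-involutive j k j+k≡1+n = trans (cong σ (σ-high j k j+k≡1+n)) (σ-high k j (trans (+-comm k j) j+k≡1+n))

  σ-high-< : ∀ j k → j + k ≡ suc n → σ (suc j + q) < m
  σ-high-< j k j+k≡1+n = subst (_< m) (sym (σ-high j k j+k≡1+n)) (+q<m (s≤s (subst (k ≤_) j+k≡1+n (m≤n+m k j))))

  σ-involutive-row : ∀ {i} → Row i → σ (σ i) ≡ i
  σ-involutive-row origin            = σ-mid
  σ-involutive-row (low y e y+e≡n) = trans (cong σ (σ-low y≤n)) (σ-low y≤n)
    where y≤n = m+n≤o⇒m≤o y (≤-reflexive y+e≡n)
  σ-involutive-row mid             = cong σ σ-mid
  σ-involutive-row next            = σ-high-involutive 0 (suc n) refl
  σ-involutive-row (high j e eq)   = σ-high-involutive (suc j) (suc e) (cong suc eq)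
  σ-involutive-row last            = σ-high-involutive (suc n) 0 (+-identityʳ (suc n))

  σ-<-row : ∀ {i} → i < m → Row i → σ i < m
  σ-<-row _   origin            = q<m
  σ-<-row i<m (low y e y+e≡n) = subst (_< m) (sym (σ-low (m+n≤o⇒m≤o y (≤-reflexive y+e≡n)))) i<m
  σ-<-row _   mid             = subst (_< m) (sym σ-mid) z<s
  σ-<-row _   next            = σ-high-< 0 (suc n) refl
  σ-<-row _   (high j e eq)   = σ-high-< (suc j) (suc e) (cong suc eq)
  σ-<-row _   last            = σ-high-< (suc n) 0 (+-identityʳ (suc n))

  σ-involutive : ∀ {i} → i < m → σ (σ i) ≡ i
  σ-involutive i<m = σ-involutive-row (row i<m)

  σ-< : ∀ {i} → i < m → σ i < m
  σ-< i<m = σ-<-row i<m (row i<m)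

  τ : ℕ → ℕ
  τ i = suc (σ i) + (suc (σ ((i + q) % m)) + suc (σ ((i + suc q) % m)))

  τ-via : ∀ i {a b x y z} → (i + q) % m ≡ a → (i + suc q) % m ≡ b →
          σ i ≡ x → σ a ≡ y → σ b ≡ z → τ i ≡ suc x + (suc y + suc z)
  τ-via _ refl refl σi σa σb = cong₂ (λ x s → suc x + s) σi (cong₂ (λ y z → suc y + suc z) σa σb)

  [a+q]%m≡a+q : ∀ {a} → a ≤ q → (a + q) % m ≡ a + q
  [a+q]%m≡a+q a≤q = m<n⇒m%n≡m (+q<m a≤q)

  %-wrap : ∀ {a x} → x ≡ a + m → a < m → x % m ≡ a
  %-wrap {a} refl a<m = trans ([m+n]%n≡m%n a m) (m<n⇒m%n≡m a<m)

  [1+a+q+q]%m≡a : ∀ a → a ≤ q → (suc a + q + q) % m ≡ a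
  [1+a+q+q]%m≡a a a≤q = %-wrap (trans (shift a q) (cong (a +_) (sym m≡1+q+q))) (≤-<-trans a≤q q<m)
    where
    shift : ∀ a q → suc a + q + q ≡ a + suc (q + q)
    shift = solve-∀

  [1+a+q+1+q]%m≡1+a : ∀ a → suc a ≤ q → (suc a + q + suc q) % m ≡ suc a
  [1+a+q+1+q]%m≡1+a a 1+a≤q = %-wrap (trans (shift a q) (cong (suc a +_) (sym m≡1+q+q))) (≤-<-trans 1+a≤q q<m)
    where
    shift : ∀ a q → suc a + q + suc q ≡ suc a + suc (q + q)
    shift = solve-∀

  rank : ∀ {i} → Row i → ℕ
  rank origin         = q
  rank (low y _ _)  = y
  rank mid          = suc n + q
  rank next         = suc n
  rank (high _ e _) = suc e + q
  rank last         = q + q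

  K : ℕ
  K = 4 * n + 11

  τ-rank-low : ∀ y e → y + e ≡ n → τ (suc y) + y ≡ K
  τ-rank-low y e y+e≡n = begin
    τ (suc y) + y
      ≡⟨ cong (_+ y) (τ-via (suc y) ([a+q]%m≡a+q (m≤n⇒m≤1+n 1+y≤1+n))
                                    (trans (cong (_% m) (+-suc (suc y) q)) ([a+q]%m≡a+q (s≤s 1+y≤1+n)))
                            (σ-low y≤n) (σ-high y (suc e) (trans (+-suc y e) (cong suc y+e≡n)))
                            (σ-high (suc y) e (cong suc y+e≡n))) ⟩
    suc (suc y) + (suc (suc (suc e) + (2 + n)) + suc (suc e + (2 + n))) + y
      ≡⟨ cong (λ x → suc (suc y) + (suc (suc (suc e) + (2 + x)) + suc (suc e + (2 + x))) + y) (sym y+e≡n) ⟩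
    suc (suc y) + (suc (suc (suc e) + (2 + (y + e))) + suc (suc e + (2 + (y + e)))) + y
      ≡⟨ solve (y ∷ e ∷ []) ⟩
    4 * (y + e) + 11
      ≡⟨ cong (λ x → 4 * x + 11) y+e≡n ⟩
    4 * n + 11 ∎
    where
    open ≡-Reasoning
    y≤n : y ≤ n
    y≤n = m+n≤o⇒m≤o y (≤-reflexive y+e≡n)
    1+y≤1+n : suc y ≤ suc n
    1+y≤1+n = s≤s y≤n

  τ-rank-high : ∀ j e → j + suc e ≡ n → τ (suc (suc j) + q) + (suc e + q) ≡ K
  τ-rank-high j e j+1+e≡n = begin
    τ (suc (suc j) + q) + (suc e + q)
      ≡⟨ cong (_+ (suc e + q)) (τ-via (suc (suc j) + q) ([1+a+q+q]%m≡a (suc j) (m≤n⇒m≤1+n (s≤s j≤n)))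
                                                            ([1+a+q+1+q]%m≡1+a (suc j) (s≤s (s≤s j≤n)))
                                        (σ-high (suc j) (suc e) (cong suc j+1+e≡n)) (σ-low j≤n) (σ-low 1+j≤n)) ⟩
    suc (suc (suc e) + (2 + n)) + (suc (suc j) + suc (suc (suc j))) + (suc e + (2 + n))
      ≡⟨ cong (λ x → suc (suc (suc e) + (2 + x)) + (suc (suc j) + suc (suc (suc j))) + (suc e + (2 + x))) (sym j+1+e≡n) ⟩
    suc (suc (suc e) + (2 + (j + suc e))) + (suc (suc j) + suc (suc (suc j))) + (suc e + (2 + (j + suc e)))
      ≡⟨ solve (j ∷ e ∷ []) ⟩
    4 * (j + suc e) + 11
      ≡⟨ cong (λ x → 4 * x + 11) j+1+e≡n ⟩
    4 * n + 11 ∎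
    where
    open ≡-Reasoning
    1+j≤n : suc j ≤ n
    1+j≤n = m+n≤o⇒m≤o (suc j) (≤-reflexive (trans (sym (+-suc j e)) j+1+e≡n))
    j≤n : j ≤ n
    j≤n = <⇒≤ 1+j≤n

  τ-rank : ∀ {i} (r : Row i) → τ i + rank r ≡ K
  τ-rank origin = begin
    τ 0 + q
      ≡⟨ cong (_+ q) (τ-via 0 ([a+q]%m≡a+q z≤n) ([a+q]%m≡a+q (s≤s z≤n)) refl σ-mid (σ-high 0 (suc n) refl)) ⟩
    suc (2 + n) + (suc 0 + suc (suc (suc n) + (2 + n))) + (2 + n)
      ≡⟨ solve (n ∷ []) ⟩
    4 * n + 11 ∎
    where open ≡-Reasoning
  τ-rank (low y e y+e≡n) = τ-rank-low y e y+e≡n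
  τ-rank mid = begin
    τ q + (suc n + q)
      ≡⟨ cong (_+ (suc n + q)) (τ-via q ([a+q]%m≡a+q ≤-refl) (trans (cong (_% m) (trans (+-suc q q) (sym m≡1+q+q))) (n%n≡0 m))
                                     σ-mid (σ-high (suc n) 0 (+-identityʳ (suc n))) refl) ⟩
    suc 0 + (suc (suc 0 + (2 + n)) + suc (2 + n)) + (suc n + (2 + n))
      ≡⟨ solve (n ∷ []) ⟩
    4 * n + 11 ∎
    where open ≡-Reasoning
  τ-rank next = begin
    τ (suc q) + suc n
      ≡⟨ cong (_+ suc n) (τ-via (suc q) ([1+a+q+q]%m≡a 0 z≤n) ([1+a+q+1+q]%m≡1+a 0 (s≤s z≤n))
                                (σ-high 0 (suc n) refl) refl (σ-low z≤n)) ⟩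
    suc (suc (suc n) + (2 + n)) + (suc (2 + n) + suc 1) + suc n
      ≡⟨ solve (n ∷ []) ⟩
    4 * n + 11 ∎
    where open ≡-Reasoning
  τ-rank (high j e j+1+e≡n) = τ-rank-high j e j+1+e≡n
  τ-rank last = begin
    τ (q + q) + (q + q)
      ≡⟨ cong (_+ (q + q)) (τ-via (q + q) ([1+a+q+q]%m≡a (suc n) (n≤1+n (suc n))) ([1+a+q+1+q]%m≡1+a (suc n) ≤-refl)
                                 (σ-high (suc n) 0 (+-identityʳ (suc n))) (σ-low ≤-refl) σ-mid) ⟩
    suc (suc 0 + (2 + n)) + (suc (suc n) + suc 0) + ((2 + n) + (2 + n))
      ≡⟨ solve (n ∷ []) ⟩
    4 * n + 11 ∎
    where open ≡-Reasoning

  row-< : ∀ {i} → Row i → i < m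
  row-< origin            = ≤q⇒<m z≤n
  row-< (low y e y+e≡n) = ≤q⇒<m (s≤s (m≤n⇒m≤1+n (m+n≤o⇒m≤o y (≤-reflexive y+e≡n))))
  row-< mid             = q<m
  row-< next            = +q<m (s≤s z≤n)
  row-< (high j e eq)   = +q<m (s≤s (s≤s (subst (j ≤_) eq (m≤m+n j (suc e)))))
  row-< last            = +q<m ≤-refl

  rank-< : ∀ {i} (r : Row i) → rank r < m
  rank-< origin            = q<m
  rank-< (low y e y+e≡n) = ≤q⇒<m (m≤n⇒m≤1+n (m≤n⇒m≤1+n (m+n≤o⇒m≤o y (≤-reflexive y+e≡n))))
  rank-< mid             = +q<m (n≤1+n (suc n))
  rank-< next            = ≤q⇒<m (n≤1+n (suc n))
  rank-< (high j e eq)   = +q<m (m≤n⇒m≤1+n (m≤n⇒m≤1+n (subst (suc e ≤_) (trans (+-comm (suc e) j) eq) (m≤m+n (suc e) j))))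
  rank-< last            = +q<m ≤-refl

  RankedRow : ℕ → Set
  RankedRow k = ∃ λ i → ∃ λ (r : Row i) → rank r ≡ k

  ranked-above-mid : ∀ e → suc e + q < m → RankedRow (suc e + q)
  ranked-above-mid e 1+e+q<m with e <? n
  ... | yes e<n = _ , high (n ∸ suc e) e (trans (+-comm (n ∸ suc e) (suc e)) (m+[n∸m]≡n e<n)) , refl
  ... | no e≮n with e ≟ n
  ...   | yes refl = _ , mid , refl
  ...   | no e≢n with e ≟ suc n
  ...     | yes refl = _ , last , refl
  ...     | no e≢1+n = contradiction 1+e+q<m (≤⇒≯ (begin
    m              ≡⟨ m≡1+q+q ⟩
    suc q + q      ≤⟨ +-monoˡ-≤ q (s≤s q≤e) ⟩
    suc e + q      ∎))
    where
    open ≤-Reasoning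
    q≤e : q ≤ e
    q≤e = ≤∧≢⇒< (≤∧≢⇒< (≮⇒≥ e≮n) (e≢n ∘ sym)) (e≢1+n ∘ sym)

  ranked : ∀ {k} → k < m → RankedRow k
  ranked {k} k<m with k ≤? n
  ... | yes k≤n = _ , low k (n ∸ k) (m+[n∸m]≡n k≤n) , refl
  ... | no k≰n with k ≟ suc n
  ...   | yes refl = _ , next , refl
  ...   | no k≢1+n with k ≟ q
  ...     | yes refl = _ , origin , refl
  ...     | no k≢q = subst RankedRow 1+e+q≡k (ranked-above-mid e (subst (_< m) (sym 1+e+q≡k) k<m))
    where
    e = k ∸ suc q
    1+e+q≡k : suc e + q ≡ k
    1+e+q≡k = trans (sym (+-suc e q)) (m∸n+n≡m (≤∧≢⇒< (≤∧≢⇒< (≰⇒> k≰n) (k≢1+n ∘ sym)) (k≢q ∘ sym)))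

  F : Fin m → Fin m
  F v = fromℕ< (σ-< (toℕ<n v))

  toℕ-F : ∀ v → toℕ (F v) ≡ σ (toℕ v)
  toℕ-F v = toℕ-fromℕ< (σ-< (toℕ<n v))

  F-involutive : ∀ v → F (F v) ≡ v
  F-involutive v = toℕ-injective (begin
    toℕ (F (F v))     ≡⟨ toℕ-F (F v) ⟩
    σ (toℕ (F v))     ≡⟨ cong σ (toℕ-F v) ⟩
    σ (σ (toℕ v))     ≡⟨ σ-involutive (toℕ<n v) ⟩
    toℕ v             ∎)
    where open ≡-Reasoning

  F-permutation : Permutation′ m
  F-permutation = permutation F F F-involutive F-involutive

  weight+τ : ∀ u → weight (harary (suc n)) F u + τ (toℕ u) ≡ ∑[ v < m ] suc (toℕ v)
  weight+τ u = begin
    weight G F u + τ i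
      ≡⟨ cong (weight G F u +_) (sym labels) ⟩
    weight G F u + (label F u + (label F (rotate q u) + label F (rotate (suc q) u)))
      ≡⟨ weight-complement G F u (≢rotate u q<m λ ()) (≢rotate u 1+q<m λ ()) (rotate-≢ u q<m 1+q<m (<⇒≢ (n<1+n q)))
                           (harary-non-neighbour u) ⟩
    ∑[ v < m ] label F v
      ≡⟨ sym (sum-permute (λ v → suc (toℕ v)) F-permutation) ⟩
    ∑[ v < m ] suc (toℕ v) ∎
    where
    open ≡-Reasoning
    G = harary (suc n)
    i = toℕ u
    1+q<m : suc q < m
    1+q<m = +q<m (s≤s z≤n)
    labels : label F u + (label F (rotate q u) + label F (rotate (suc q) u)) ≡ τ i
    labels = cong₂ (λ x s → suc x + s) (toℕ-F u)
                   (cong₂ (λ y z → suc y + suc z) (trans (toℕ-F (rotate q u)) (cong σ (toℕ-rotate q u)))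
                                                  (trans (toℕ-F (rotate (suc q) u)) (cong σ (toℕ-rotate (suc q) u))))

  A : ℕ
  A = 2 * (suc n * suc n) + 3 * suc n ∸ 1

  A+K≡∑ : A + K ≡ ∑[ v < m ] suc (toℕ v)
  A+K≡∑ = *-cancelˡ-≡ (A + K) _ 2 (begin
    2 * (A + K)
      ≡⟨ cong (λ a → 2 * (a ∸ 1 + K)) 2n²+7n+5≡ ⟩
    2 * (2 * n * n + 7 * n + 4 + (4 * n + 11))
      ≡⟨ solve (n ∷ []) ⟩
    (3 + 2 * suc n) * suc (3 + 2 * suc n)
      ≡⟨ sym (double-∑-suc-toℕ m) ⟩
    2 * ∑[ v < m ] suc (toℕ v) ∎)
    where
    open ≡-Reasoning
    2n²+7n+5≡ : 2 * (suc n * suc n) + 3 * suc n ≡ suc (2 * n * n + 7 * n + 4)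
    2n²+7n+5≡ = solve (n ∷ [])

  weight-from-rank : ∀ u k → τ (toℕ u) + k ≡ K → weight (harary (suc n)) F u ≡ A + k * 1
  weight-from-rank u k τ+k≡K = begin
    weight (harary (suc n)) F u ≡⟨ +-cancelʳ-≡ (τ (toℕ u)) _ _ (begin
      weight (harary (suc n)) F u + τ (toℕ u) ≡⟨ weight+τ u ⟩
      ∑[ v < m ] suc (toℕ v)                 ≡⟨ sym A+K≡∑ ⟩
      A + K                                  ≡⟨ cong (A +_) (trans (sym τ+k≡K) (+-comm (τ (toℕ u)) k)) ⟩
      A + (k + τ (toℕ u))                    ≡⟨ sym (+-assoc A k (τ (toℕ u))) ⟩
      A + k + τ (toℕ u)                      ∎) ⟩
    A + k                       ≡⟨ cong (A +_) (sym (*-identityʳ k)) ⟩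
    A + k * 1                   ∎
    where open ≡-Reasoning

mainTheorem11 : (n : ℕ) → IsDistanceAntimagic (harary (suc n)) (2 * (suc n * suc n) + 3 * suc n ∸ 1) 1
mainTheorem11 n = F , Bijection.bijective (↔⇒⤖ F-permutation) , weight-in-range , weight-attained
  where
  open Labelling n
  open HararyNeighbourhood (suc n) using (m)
  weight-in-range : ∀ u → ∃ λ k → k < m × weight (harary (suc n)) F u ≡ A + k * 1
  weight-in-range u = let r = row (toℕ<n u) in rank r , rank-< r , weight-from-rank u (rank r) (τ-rank r)
  weight-attained : ∀ k → k < m → ∃ λ u → weight (harary (suc n)) F u ≡ A + k * 1
  weight-attained k k<m with ranked k<m
  ... | i , r , refl = v , weight-from-rank v k (subst (λ j → τ j + rank r ≡ K) (sym (toℕ-fromℕ< (row-< r))) (τ-rank r))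
    where
    v = fromℕ< (row-< r)
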